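{- For all integers $d\ge 1$ and $n\ge 0$, $$|P_n^{d+1}| = |P_n^d| + 2\sum_{k=0}^{n-1}|P_k^d| \;=\; 2\sum_{k=0}^{n}|P_k^d| - |P_n^d|.$$
   Context: For integers $d\ge 1$ and $n\ge 0$, let $e_1,\dots,e_d$ be the standard unit vectors of $\mathbb{Z}^d$ and let $P_n^d=\{X_1+X_2+\cdots+X_n : X_i\in\{\pm e_1,\dots,\pm e_d\}\text{ for } i=1,\dots,n\}\subseteq\mathbb{Z}^d$ be the set of possible positions of a nearest-neighbour walk in $\mathbb{Z}^d$ starting at the origin after exactly $n$ unit steps (so $P_0^d=\{0\}$). $|P_n^d|$ denotes its cardinality. -}

module Defs where

open import Data.Nat using (ℕ; zero; suc)
open import Data.Integer as ℤ using (ℤ)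
open import Data.Fin using (Fin)
open import Data.List using (List; []; _∷_; map; concatMap; length; deduplicate; foldr; allFin; _++_; sum)
open import Data.Vec as Vec using (Vec; replicate; zipWith)
import Data.Vec.Properties as VecP
import Data.Integer.Properties as ℤP

Point : ℕ → Set
Point d = Vec ℤ d

origin : ∀ {d} → Point d
origin = replicate _ (ℤ.+ 0)

_⊕_ : ∀ {d} → Point d → Point d → Point d
_⊕_ = zipWith ℤ._+_

unit : ∀ {d} → Fin d → Point d
unit i = Vec.updateAt (replicate _ (ℤ.+ 0)) i (λ _ → ℤ.+ 1)

negUnit : ∀ {d} → Fin d → Point d
negUnit i = Vec.updateAt (replicate _ (ℤ.+ 0)) i (λ _ → ℤ.- (ℤ.+ 1))

steps : (d : ℕ) → List (Point d)
steps d = map unit (allFin d) ++ map negUnit (allFin d)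

walks : (d n : ℕ) → List (List (Point d))
walks d zero = [] ∷ []
walks d (suc n) = concatMap (λ x → map (x ∷_) (walks d n)) (steps d)

endpoint : ∀ {d} → List (Point d) → Point d
endpoint = foldr _⊕_ origin

Plist : (d n : ℕ) → List (Point d)
Plist d n = map endpoint (walks d n)

card : (d n : ℕ) → ℕ
card d n = length (deduplicate (VecP.≡-dec ℤP._≟_) (Plist d n))

sumBelow : ℕ → (ℕ → ℕ) → ℕ
sumBelow zero f = 0
sumBelow (suc m) f = sumBelow m f Data.Nat.+ f m

-- For d ≥ 1, P_n^d is the set of points x with ‖x‖₁ ≤ n and ‖x‖₁ ≡ n (mod 2): every step changes
-- the ℓ¹ norm by exactly one, and conversely a shortest walk to x can be padded by back-and-forth
-- steps along e₁. Sorting the points of P_n^{d+1} by the absolute value of their first coordinate,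
-- which is either 0 (the rest lies in P_n^d) or n − k for some k < n (two signs, the rest in P_k^d),
-- gives the recurrence.
module Submission where

open import Defs
open import Data.Nat using (ℕ; zero; suc; _+_; _*_; _∸_; _≥_; _<_; _≤_; s≤s; z≤n)
import Data.Nat.Properties as ℕ
open import Data.Nat.Tactic.RingSolver using (solve-∀)
open import Data.Integer as ℤ using (ℤ; +_; -[1+_]; ∣_∣)
import Data.Integer.Properties as ℤ
open import Data.Fin using (Fin; zero; suc)
open import Data.List using (List; []; _∷_; [_]; map; length; _++_; allFin)
open import Data.List.Properties using (length-++; length-map)
open import Data.List.Membership.Propositional using (_∈_; find; lose)
open import Data.List.Membership.Propositional.Properties
open import Data.List.Membership.Propositional.Properties.WithK using (unique∧set⇒bag)
open import Data.List.Relation.Unary.Any using (here)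
open import Data.List.Relation.Unary.AllPairs using ([]; _∷_)
open import Data.List.Relation.Unary.All using ([])
open import Data.List.Relation.Unary.Unique.Propositional using (Unique)
import Data.List.Relation.Unary.Unique.Propositional.Properties as Unique
import Data.List.Relation.Unary.Unique.DecPropositional.Properties as DecUnique
open import Data.List.Relation.Binary.BagAndSetEquality using (∼bag⇒↭)
open import Data.List.Relation.Binary.Permutation.Propositional.Properties using (↭-length)
open import Data.Vec as Vec using ([]; _∷_)
import Data.Vec.Properties as Vec
open import Data.Product using (Σ; _×_; _,_; proj₁)
open import Data.Sum using (_⊎_; inj₁; inj₂)
open import Function.Bundles using (mk⇔)
open import Relation.Nullary using (¬_)
open import Relation.Binary.PropositionalEquality using (_≡_; refl; sym; trans; cong; cong₂; subst; module ≡-Reasoning)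

private
  variable
    d m n j a : ℕ

unique∧sameElements⇒length≡ : {A : Set} {xs ys : List A} → Unique xs → Unique ys →
  (∀ {x} → x ∈ xs → x ∈ ys) → (∀ {x} → x ∈ ys → x ∈ xs) → length xs ≡ length ys
unique∧sameElements⇒length≡ xs! ys! xs⊆ys ys⊆xs =
  ↭-length (∼bag⇒↭ (unique∧set⇒bag xs! ys! (mk⇔ xs⊆ys ys⊆xs)))

sumBelow-cong : ∀ n {f g : ℕ → ℕ} → (∀ k → f k ≡ g k) → sumBelow n f ≡ sumBelow n g
sumBelow-cong zero    f≗g = refl
sumBelow-cong (suc n) f≗g = cong₂ _+_ (sumBelow-cong n f≗g) (f≗g n)

-- Comparison up to parity

infix 4 _≤₂_
record _≤₂_ (m n : ℕ) : Set where
  constructor slack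
  field
    k      : ℕ
    m+2k≡n : m + (k + k) ≡ n

≤₂-refl : ∀ m → m ≤₂ m
≤₂-refl m = slack 0 (ℕ.+-identityʳ m)

≤₂0⇒≡0 : m ≤₂ 0 → m ≡ 0
≤₂0⇒≡0 {m} (slack k e) = ℕ.m+n≡0⇒m≡0 m e

≤₂-suc⁻ : suc m ≤₂ suc n → m ≤₂ n
≤₂-suc⁻ (slack k e) = slack k (ℕ.suc-injective e)

+-double-suc : ∀ m k → m + (suc k + suc k) ≡ suc (suc m + (k + k))
+-double-suc = solve-∀

≤₂-step : m ≤₂ n → m ≤₂ suc (suc n)
≤₂-step {m} (slack k e) = slack (suc k) (trans (+-double-suc m k) (cong (λ z → suc (suc z)) e))

0≤₂1+n⇒1≤₂n : 0 ≤₂ suc n → 1 ≤₂ n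
0≤₂1+n⇒1≤₂n (slack (suc k) e) = slack k (ℕ.suc-injective (trans (sym (+-double-suc 0 k)) e))

+-≤₂-split : ∀ a m → a + m ≤₂ n → Σ ℕ λ j → m ≤₂ j × a + j ≡ n
+-≤₂-split a m (slack k e) = m + (k + k) , slack k refl , trans (sym (ℕ.+-assoc a m (k + k))) e

∸-≤₂-join : j ≤ n → m ≤₂ j → n ∸ j + m ≤₂ n
∸-≤₂-join {j} {n} {m} j≤n (slack k e) = slack k (begin
  n ∸ j + m + (k + k)   ≡⟨ ℕ.+-assoc (n ∸ j) m (k + k) ⟩
  n ∸ j + (m + (k + k)) ≡⟨ cong (λ z → n ∸ j + z) e ⟩
  n ∸ j + j             ≡⟨ ℕ.m∸n+n≡m j≤n ⟩
  n                     ∎)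
  where open ≡-Reasoning

1+a+j≡n⇒j<n∧n∸j≡1+a : suc a + j ≡ n → j < n × n ∸ j ≡ suc a
1+a+j≡n⇒j<n∧n∸j≡1+a {a} {j} refl = ℕ.m<n+m j (s≤s z≤n) , ℕ.m+n∸n≡m (suc a) j

Adjacent : ℕ → ℕ → Set
Adjacent m n = m ≡ suc n ⊎ suc m ≡ n

Adjacent-+ʳ : ∀ c {m n} → Adjacent m n → Adjacent (m + c) (n + c)
Adjacent-+ʳ c (inj₁ e) = inj₁ (cong (_+ c) e)
Adjacent-+ʳ c (inj₂ e) = inj₂ (cong (_+ c) e)

Adjacent-+ˡ : ∀ c {m n} → Adjacent m n → Adjacent (c + m) (c + n)
Adjacent-+ˡ c {n = n} (inj₁ e) = inj₁ (trans (cong (λ z → c + z) e) (ℕ.+-suc c n))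
Adjacent-+ˡ c {m = m} (inj₂ e) = inj₂ (trans (sym (ℕ.+-suc c m)) (cong (λ z → c + z) e))

≤₂-adjacent : ∀ {m m′} → Adjacent m m′ → m′ ≤₂ n → m ≤₂ suc n
≤₂-adjacent         (inj₁ refl) (slack k e) = slack k (cong suc e)
≤₂-adjacent {m = m} (inj₂ refl) (slack k e) = slack (suc k) (trans (+-double-suc m k) (cong suc e))

-- Enumerating the points of norm ≤₂ n

‖_‖ : Point d → ℕ
‖ []    ‖ = 0
‖ a ∷ x ‖ = ∣ a ∣ + ‖ x ‖

withHead : ℤ → List (Point d) → List (Point (suc d))
withHead t = map (t ∷_)

∈-withHead⁻ : ∀ {s t y} {L : List (Point d)} → (s ∷ y) ∈ withHead t L → s ≡ t × y ∈ L
∈-withHead⁻ {t = t} p with ∈-map⁻ (t ∷_) p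
... | _ , y∈L , refl = refl , y∈L

∈-withHead⁺ : ∀ {t y} {L : List (Point d)} → y ∈ L → (t ∷ y) ∈ withHead t L
∈-withHead⁺ {t = t} = ∈-map⁺ (t ∷_)

withHead-unique : ∀ t {L : List (Point d)} → Unique L → Unique (withHead t L)
withHead-unique t = Unique.map⁺ Vec.∷-injectiveʳ

signedHeads : ℕ → List (Point d) → List (Point (suc d))
signedHeads a L = withHead (+ a) L ++ withHead (ℤ.- + a) L

∈-signedHeads⁻ : ∀ {t y} {L : List (Point d)} → (t ∷ y) ∈ signedHeads a L → ∣ t ∣ ≡ a × y ∈ L
∈-signedHeads⁻ {a = a} {L = L} p with ∈-++⁻ (withHead (+ a) L) p
... | inj₁ q with ∈-withHead⁻ q
...   | refl , y∈L = refl , y∈L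
∈-signedHeads⁻ {a = a} p | inj₂ q with ∈-withHead⁻ q
...   | refl , y∈L = ℤ.∣-i∣≡∣i∣ (+ a) , y∈L

∈-signedHeads⁺ : ∀ {t y} {L : List (Point d)} → ∣ t ∣ ≡ a → y ∈ L → (t ∷ y) ∈ signedHeads a L
∈-signedHeads⁺ {t = + _}      refl y∈L = ∈-++⁺ˡ (∈-withHead⁺ y∈L)
∈-signedHeads⁺ {t = -[1+ _ ]} refl y∈L = ∈-++⁺ʳ _ (∈-withHead⁺ y∈L)

+a≡-+a⇒a≡0 : ∀ a → + a ≡ ℤ.- + a → a ≡ 0
+a≡-+a⇒a≡0 zero    _ = refl
+a≡-+a⇒a≡0 (suc a) ()

signedHeads-unique : ∀ {L : List (Point d)} → ¬ a ≡ 0 → Unique L → Unique (signedHeads a L)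
signedHeads-unique {a = a} {L} a≢0 L! =
  Unique.++⁺ (withHead-unique _ L!) (withHead-unique _ L!) disjoint
  where
  disjoint : ∀ {v} → ¬ (v ∈ withHead (+ a) L × v ∈ withHead (ℤ.- + a) L)
  disjoint {_ ∷ _} (p , q) =
    a≢0 (+a≡-+a⇒a≡0 a (trans (sym (proj₁ (∈-withHead⁻ p))) (proj₁ (∈-withHead⁻ q))))

length-signedHeads : ∀ a (L : List (Point d)) → length (signedHeads a L) ≡ 2 * length L
length-signedHeads a L = begin
  length (signedHeads a L)                                   ≡⟨ length-++ (withHead (+ a) L) ⟩
  length (withHead (+ a) L) + length (withHead (ℤ.- + a) L) ≡⟨ cong₂ _+_ (length-map _ L) (length-map _ L) ⟩
  length L + length L                                        ≡⟨ cong (λ z → length L + z) (ℕ.+-identityʳ (length L)) ⟨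
  2 * length L                                               ∎
  where open ≡-Reasoning

shells : (ℕ → List (Point d)) → ℕ → ℕ → List (Point (suc d))
shells f n zero    = []
shells f n (suc m) = shells f n m ++ signedHeads (n ∸ m) (f m)

∈-shells⁻ : ∀ {f : ℕ → List (Point d)} {t y} → (t ∷ y) ∈ shells f n m →
  Σ ℕ λ j → j < m × ∣ t ∣ ≡ n ∸ j × y ∈ f j
∈-shells⁻ {m = suc m} {f = f} p with ∈-++⁻ (shells f _ m) p
... | inj₁ q with ∈-shells⁻ q
...   | j , j<m , ∣t∣≡ , y∈ = j , ℕ.m<n⇒m<1+n j<m , ∣t∣≡ , y∈
∈-shells⁻ {m = suc m} p | inj₂ q with ∈-signedHeads⁻ q
...   | ∣t∣≡ , y∈ = m , ℕ.n<1+n m , ∣t∣≡ , y∈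

∈-shells⁺ : ∀ {f : ℕ → List (Point d)} {t y} → j < m → ∣ t ∣ ≡ n ∸ j → y ∈ f j → (t ∷ y) ∈ shells f n m
∈-shells⁺ {m = suc m} {f = f} j<1+m ∣t∣≡ y∈ with ℕ.m<1+n⇒m<n∨m≡n j<1+m
... | inj₁ j<m  = ∈-++⁺ˡ (∈-shells⁺ j<m ∣t∣≡ y∈)
... | inj₂ refl = ∈-++⁺ʳ (shells f _ m) (∈-signedHeads⁺ ∣t∣≡ y∈)

shells-unique : ∀ (f : ℕ → List (Point d)) → m ≤ n → (∀ k → Unique (f k)) → Unique (shells f n m)
shells-unique {m = zero}          f _     f! = []
shells-unique {m = suc m} {n = n} f 1+m≤n f! =
  Unique.++⁺ (shells-unique f (ℕ.<⇒≤ 1+m≤n) f!) (signedHeads-unique n∸m≢0 (f! m)) disjoint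
  where
  n∸m≢0 : ¬ n ∸ m ≡ 0
  n∸m≢0 e = ℕ.<⇒≱ 1+m≤n (ℕ.m∸n≡0⇒m≤n e)
  disjoint : ∀ {v} → ¬ (v ∈ shells f n m × v ∈ signedHeads (n ∸ m) (f m))
  disjoint {_ ∷ _} (p , q) with ∈-shells⁻ {n = n} {m = m} p | ∈-signedHeads⁻ {L = f m} q
  ... | j , j<m , ∣t∣≡n∸j , _ | ∣t∣≡n∸m , _ =
    ℕ.<⇒≢ j<m (ℕ.∸-cancelˡ-≡ (ℕ.<⇒≤ (ℕ.<-trans j<m 1+m≤n)) (ℕ.<⇒≤ 1+m≤n)
                              (trans (sym ∣t∣≡n∸j) ∣t∣≡n∸m))

length-shells : ∀ (f : ℕ → List (Point d)) n m →
  length (shells f n m) ≡ 2 * sumBelow m (λ k → length (f k))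
length-shells f n zero    = refl
length-shells f n (suc m) = begin
  length (shells f n m ++ signedHeads (n ∸ m) (f m))       ≡⟨ length-++ (shells f n m) ⟩
  length (shells f n m) + length (signedHeads (n ∸ m) (f m)) ≡⟨ cong₂ _+_ (length-shells f n m) (length-signedHeads (n ∸ m) (f m)) ⟩
  2 * sumBelow m ∣f∣ + 2 * length (f m)                    ≡⟨ ℕ.*-distribˡ-+ 2 (sumBelow m ∣f∣) (length (f m)) ⟨
  2 * sumBelow (suc m) ∣f∣                                 ∎
  where
  open ≡-Reasoning
  ∣f∣ : ℕ → ℕ
  ∣f∣ k = length (f k)

ball : (d n : ℕ) → List (Point d)
ball zero    zero          = [ [] ]
ball zero    (suc zero)    = []
ball zero    (suc (suc n)) = ball zero n
ball (suc d) n             = withHead (+ 0) (ball d n) ++ shells (ball d) n n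

∈-ball⁻ : ∀ {x : Point d} → x ∈ ball d n → ‖ x ‖ ≤₂ n
∈-ball⁻ {zero}  {zero}        (here refl) = ≤₂-refl 0
∈-ball⁻ {zero}  {suc (suc n)} p           = ≤₂-step (∈-ball⁻ p)
∈-ball⁻ {suc d} {n} {t ∷ y}   p with ∈-++⁻ (withHead (+ 0) (ball d n)) p
... | inj₁ q with ∈-withHead⁻ q
...   | refl , y∈ = ∈-ball⁻ y∈
∈-ball⁻ {suc d} {n} {t ∷ y} p | inj₂ q with ∈-shells⁻ q
...   | j , j<n , ∣t∣≡n∸j , y∈ rewrite ∣t∣≡n∸j = ∸-≤₂-join (ℕ.<⇒≤ j<n) (∈-ball⁻ y∈)

∈-ball⁺ : ∀ {x : Point d} → ‖ x ‖ ≤₂ n → x ∈ ball d n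
∈-ball⁺ {zero}  {zero}        {[]} _ = here refl
∈-ball⁺ {zero}  {suc zero}    {[]} h with 0≤₂1+n⇒1≤₂n h
... | slack _ ()
∈-ball⁺ {zero}  {suc (suc n)} {[]} h = ∈-ball⁺ (≤₂-suc⁻ (0≤₂1+n⇒1≤₂n h))
∈-ball⁺ {suc d} {n} {t ∷ y} h with ∣ t ∣ in ∣t∣≡
... | zero = subst (λ t → (t ∷ y) ∈ ball (suc d) n) (sym (ℤ.∣i∣≡0⇒i≡0 ∣t∣≡))
                  (∈-++⁺ˡ (∈-withHead⁺ (∈-ball⁺ h)))
... | suc a with +-≤₂-split (suc a) ‖ y ‖ h
...   | j , ‖y‖≤₂j , 1+a+j≡n with 1+a+j≡n⇒j<n∧n∸j≡1+a 1+a+j≡n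
...     | j<n , n∸j≡1+a =
  ∈-++⁺ʳ _ (∈-shells⁺ j<n (trans ∣t∣≡ (sym n∸j≡1+a)) (∈-ball⁺ ‖y‖≤₂j))

ball-unique : ∀ d n → Unique (ball d n)
ball-unique zero    zero          = [] ∷ []
ball-unique zero    (suc zero)    = []
ball-unique zero    (suc (suc n)) = ball-unique zero n
ball-unique (suc d) n =
  Unique.++⁺ (withHead-unique _ (ball-unique d n))
             (shells-unique {n = n} (ball d) ℕ.≤-refl (ball-unique d)) disjoint
  where
  disjoint : ∀ {v} → ¬ (v ∈ withHead (+ 0) (ball d n) × v ∈ shells (ball d) n n)
  disjoint {_ ∷ _} (p , q) with ∈-withHead⁻ p | ∈-shells⁻ {n = n} {m = n} q
  ... | refl , _ | j , j<n , 0≡n∸j , _ = ℕ.<⇒≱ j<n (ℕ.m∸n≡0⇒m≤n (sym 0≡n∸j))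

length-ball : ∀ d n →
  length (ball (suc d) n) ≡ length (ball d n) + 2 * sumBelow n (λ k → length (ball d k))
length-ball d n =
  trans (length-++ (withHead (+ 0) (ball d n)))
        (cong₂ _+_ (length-map (+ 0 ∷_) (ball d n)) (length-shells (ball d) n n))

IsStep : Point d → Set
IsStep {d} s = (Σ (Fin d) λ i → s ≡ unit i) ⊎ (Σ (Fin d) λ i → s ≡ negUnit i)

∈-steps⁻ : ∀ {s : Point d} → s ∈ steps d → IsStep s
∈-steps⁻ {d} p with ∈-++⁻ (map unit (allFin d)) p
... | inj₁ q with ∈-map⁻ unit q
...   | i , _ , e = inj₁ (i , e)
∈-steps⁻ p | inj₂ q with ∈-map⁻ negUnit q
...   | i , _ , e = inj₂ (i , e)

∈-steps⁺ : ∀ {s : Point d} → IsStep s → s ∈ steps d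
∈-steps⁺     (inj₁ (i , refl)) = ∈-++⁺ˡ (∈-map⁺ unit (∈-allFin i))
∈-steps⁺ {d} (inj₂ (i , refl)) = ∈-++⁺ʳ (map unit (allFin d)) (∈-map⁺ negUnit (∈-allFin i))

∈-Plist-suc⁻ : ∀ {v : Point d} → v ∈ Plist d (suc n) →
  Σ (Point d) λ s → IsStep s × Σ (Point d) λ y → y ∈ Plist d n × v ≡ s ⊕ y
∈-Plist-suc⁻ {d} {n} p with ∈-map⁻ endpoint p
... | w , w∈ , refl with find (∈-concatMap⁻ (λ s → map (s ∷_) (walks d n)) {xs = steps d} w∈)
...   | s , s∈ , q with ∈-map⁻ (s ∷_) q
...     | w′ , w′∈ , refl = s , ∈-steps⁻ s∈ , endpoint w′ , ∈-map⁺ endpoint w′∈ , refl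

∈-Plist-suc⁺ : ∀ {s y : Point d} → IsStep s → y ∈ Plist d n → (s ⊕ y) ∈ Plist d (suc n)
∈-Plist-suc⁺ {d} {n} {s} step y∈ with ∈-map⁻ endpoint y∈
... | w , w∈ , refl = ∈-map⁺ endpoint
  (∈-concatMap⁺ (λ x → map (x ∷_) (walks d n)) (lose (∈-steps⁺ step) (∈-map⁺ (s ∷_) w∈)))

⊕-identityˡ : ∀ (y : Point d) → origin ⊕ y ≡ y
⊕-identityˡ = Vec.zipWith-identityˡ ℤ.+-identityˡ

‖origin‖≡0 : ∀ d → ‖ origin {d} ‖ ≡ 0
‖origin‖≡0 zero    = refl
‖origin‖≡0 (suc d) = ‖origin‖≡0 d

‖x‖≡0⇒x≡origin : ∀ (x : Point d) → ‖ x ‖ ≡ 0 → x ≡ origin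
‖x‖≡0⇒x≡origin []      _ = refl
‖x‖≡0⇒x≡origin (a ∷ x) e = cong₂ _∷_ (ℤ.∣i∣≡0⇒i≡0 (ℕ.m+n≡0⇒m≡0 ∣ a ∣ e))
                                     (‖x‖≡0⇒x≡origin x (ℕ.m+n≡0⇒n≡0 ∣ a ∣ e))

Adjacent-∣1+i∣ : ∀ i → Adjacent ∣ + 1 ℤ.+ i ∣ ∣ i ∣
Adjacent-∣1+i∣ (+ _)           = inj₁ refl
Adjacent-∣1+i∣ -[1+ zero ]     = inj₂ refl
Adjacent-∣1+i∣ -[1+ suc _ ]    = inj₂ refl

Adjacent-∣-1+i∣ : ∀ i → Adjacent ∣ -[1+ 0 ] ℤ.+ i ∣ ∣ i ∣
Adjacent-∣-1+i∣ (+ zero)  = inj₁ refl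
Adjacent-∣-1+i∣ (+ suc _) = inj₂ refl
Adjacent-∣-1+i∣ -[1+ _ ]  = inj₁ refl

Adjacent-‖axis⊕‖ : ∀ σ → (∀ i → Adjacent ∣ σ ℤ.+ i ∣ ∣ i ∣) → ∀ (k : Fin d) y →
  Adjacent ‖ Vec.updateAt origin k (λ _ → σ) ⊕ y ‖ ‖ y ‖
Adjacent-‖axis⊕‖ σ adj zero (a ∷ y) rewrite ⊕-identityˡ y = Adjacent-+ʳ ‖ y ‖ (adj a)
Adjacent-‖axis⊕‖ σ adj (suc k) (a ∷ y) rewrite ℤ.+-identityˡ a =
  Adjacent-+ˡ ∣ a ∣ (Adjacent-‖axis⊕‖ σ adj k y)

Adjacent-‖step⊕‖ : ∀ {s : Point d} → IsStep s → ∀ y → Adjacent ‖ s ⊕ y ‖ ‖ y ‖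
Adjacent-‖step⊕‖ (inj₁ (k , refl)) = Adjacent-‖axis⊕‖ (+ 1) Adjacent-∣1+i∣ k
Adjacent-‖step⊕‖ (inj₂ (k , refl)) = Adjacent-‖axis⊕‖ -[1+ 0 ] Adjacent-∣-1+i∣ k

∈-Plist⇒≤₂ : ∀ d n {x} → x ∈ Plist d n → ‖ x ‖ ≤₂ n
∈-Plist⇒≤₂ d zero    (here refl) = slack 0 (trans (ℕ.+-identityʳ _) (‖origin‖≡0 d))
∈-Plist⇒≤₂ d (suc n) p with ∈-Plist-suc⁻ {n = n} p
... | s , step , y , y∈ , refl = ≤₂-adjacent (Adjacent-‖step⊕‖ step y) (∈-Plist⇒≤₂ d n y∈)

peel : ∀ (x : Point d) {m} → ‖ x ‖ ≡ suc m →
  Σ (Point d) λ s → IsStep s × Σ (Point d) λ y → x ≡ s ⊕ y × ‖ y ‖ ≡ m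
peel (+ zero ∷ x) e with peel x e
... | s , step , y , refl , ‖y‖≡m = (+ 0 ∷ s) , shift step , (+ 0 ∷ y) , refl , ‖y‖≡m
  where
  shift : IsStep s → IsStep (+ 0 ∷ s)
  shift (inj₁ (i , refl)) = inj₁ (suc i , refl)
  shift (inj₂ (i , refl)) = inj₂ (suc i , refl)
peel (+ suc a ∷ x) e =
  unit zero , inj₁ (zero , refl) , (+ a ∷ x) , cong (+ suc a ∷_) (sym (⊕-identityˡ x)) , ℕ.suc-injective e
peel (-[1+ zero ] ∷ x) e =
  negUnit zero , inj₂ (zero , refl) , (+ 0 ∷ x) , cong (-[1+ 0 ] ∷_) (sym (⊕-identityˡ x)) , ℕ.suc-injective e
peel (-[1+ suc a ] ∷ x) e =
  negUnit zero , inj₂ (zero , refl) , (-[1+ a ] ∷ x) , cong (-[1+ suc a ] ∷_) (sym (⊕-identityˡ x)) , ℕ.suc-injective e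

unit⊕negUnit≡origin : ∀ d → unit {suc d} zero ⊕ negUnit zero ≡ origin
unit⊕negUnit≡origin d = cong (+ 0 ∷_) (⊕-identityˡ origin)

‖negUnit‖≡1 : ∀ d → ‖ negUnit {suc d} zero ‖ ≡ 1
‖negUnit‖≡1 d = cong suc (‖origin‖≡0 d)

-- Fails for d = 0 and n > 0: wasting two steps at the origin needs a direction e₁ to go back and forth.
≤₂⇒∈-Plist : ∀ d n (x : Point (suc d)) → ‖ x ‖ ≤₂ n → x ∈ Plist (suc d) n
≤₂⇒∈-Plist d zero    x h = here (‖x‖≡0⇒x≡origin x (≤₂0⇒≡0 h))
≤₂⇒∈-Plist d (suc n) x h with ‖ x ‖ in ‖x‖≡
... | suc m with peel x ‖x‖≡
...   | s , step , y , refl , ‖y‖≡m =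
  ∈-Plist-suc⁺ {n = n} step (≤₂⇒∈-Plist d n y (subst (_≤₂ n) (sym ‖y‖≡m) (≤₂-suc⁻ h)))
≤₂⇒∈-Plist d (suc n) x h | zero =
  subst (_∈ Plist (suc d) (suc n)) (trans (unit⊕negUnit≡origin d) (sym (‖x‖≡0⇒x≡origin x ‖x‖≡)))
    (∈-Plist-suc⁺ {n = n} (inj₁ (zero , refl))
      (≤₂⇒∈-Plist d n (negUnit zero) (subst (_≤₂ n) (sym (‖negUnit‖≡1 d)) (0≤₂1+n⇒1≤₂n h))))

card≡length-ball : ∀ d n → card (suc d) n ≡ length (ball (suc d) n)
card≡length-ball d n = unique∧sameElements⇒length≡
  (DecUnique.deduplicate-! ≟-Point (Plist (suc d) n)) (ball-unique (suc d) n)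
  (λ p → ∈-ball⁺ (∈-Plist⇒≤₂ (suc d) n (∈-deduplicate⁻ ≟-Point (Plist (suc d) n) p)))
  (λ p → ∈-deduplicate⁺ ≟-Point (≤₂⇒∈-Plist d n _ (∈-ball⁻ p)))
  where ≟-Point = Vec.≡-dec ℤ._≟_

card-recurrence : ∀ d n → card (suc (suc d)) n ≡ card (suc d) n + 2 * sumBelow n (card (suc d))
card-recurrence d n = begin
  card (suc (suc d)) n                                                  ≡⟨ card≡length-ball (suc d) n ⟩
  length (ball (suc (suc d)) n)                                         ≡⟨ length-ball (suc d) n ⟩
  length (ball (suc d) n) + 2 * sumBelow n (λ k → length (ball (suc d) k))
    ≡⟨ cong₂ (λ c s → c + 2 * s) (card≡length-ball d n) (sumBelow-cong n (card≡length-ball d)) ⟨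
  card (suc d) n + 2 * sumBelow n (card (suc d))                        ∎
  where open ≡-Reasoning

2*[a+b]∸b≡b+2*a : ∀ a b → 2 * (a + b) ∸ b ≡ b + 2 * a
2*[a+b]∸b≡b+2*a a b = begin
  2 * (a + b) ∸ b   ≡⟨ cong (_∸ b) (2*[a+b]≡b+2*a+b a b) ⟩
  b + 2 * a + b ∸ b ≡⟨ ℕ.m+n∸n≡m (b + 2 * a) b ⟩
  b + 2 * a         ∎
  where
  open ≡-Reasoning
  2*[a+b]≡b+2*a+b : ∀ a b → 2 * (a + b) ≡ b + 2 * a + b
  2*[a+b]≡b+2*a+b = solve-∀

mainTheorem1 : (d n : ℕ) → d ≥ 1 →
    (card (suc d) n ≡ card d n + 2 * sumBelow n (card d))
    × (card (suc d) n ≡ 2 * sumBelow (suc n) (card d) ∸ card d n)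
mainTheorem1 (suc d) n _ =
  card-recurrence d n ,
  trans (card-recurrence d n) (sym (2*[a+b]∸b≡b+2*a (sumBelow n (card (suc d))) (card (suc d) n)))
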